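{- The set $S''=\{UD-DU\colon U \text{ an upper prime},\ D \text{ a lower prime}\}$ generates the two-sided ideal $\mathcal{J}$ of $\mathcal{A}$.
   Context: Let $\mathcal{A}$ be the free associative $\mathbb{C}$-algebra on two generators $L$ and $R$ (letters). A word is a finite product of letters (possibly empty). A word is balanced if $L$ and $R$ occur in it equally many times. Let $S=\{FG-GF\colon F,G \text{ nonempty balanced words}\}$ and let $\mathcal{J}$ be the two-sided ideal of $\mathcal{A}$ generated by $S$. A word is prime if it is nonempty, balanced, and not a product of two nonempty balanced words. For a word $W=a_1\cdots a_n$ and $0\le k\le n$, $e_k(W)=\sum_{i=1}^k\overline{a_i}$ with $\overline{R}=1$, $\overline{L}=-1$. A prime $P$ is an upper prime if $e_k(P)>0$ for $1\le k\le l(P)-1$, and a lower prime if $e_k(P)<0$ for $1\le k\le l(P)-1$, where $l(P)$ is the length of $P$. -}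

module Defs where

open import Level using (Level; _⊔_)
open import Data.Nat using (ℕ; zero; suc; _<_; _≤_)
open import Data.Integer as ℤ using (ℤ; +_; 0ℤ; 1ℤ; -1ℤ)
open import Data.List using (List; []; _∷_; _++_; length; take; concat; map)
open import Data.List.Properties using (≡-dec)
open import Data.List.Relation.Unary.All using (All)
open import Data.Product using (Σ; ∃; _×_; _,_)
open import Relation.Nullary using (¬_; Dec; yes; no)
open import Relation.Binary.PropositionalEquality using (_≡_; _≢_; refl)
open import Algebra.Bundles using (CommutativeRing)

data Letter : Set where
  L R : Letter

_≟L_ : (a b : Letter) → Dec (a ≡ b)
L ≟L L = yes refl
L ≟L R = no (λ ())
R ≟L L = no (λ ())
R ≟L R = yes refl

Word : Set
Word = List Letter

_≟W_ : (u v : Word) → Dec (u ≡ v)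
_≟W_ = ≡-dec _≟L_

countL countR : Word → ℕ
countL []      = 0
countL (L ∷ w) = suc (countL w)
countL (R ∷ w) = countL w
countR []      = 0
countR (L ∷ w) = countR w
countR (R ∷ w) = suc (countR w)

Balanced : Word → Set
Balanced w = countL w ≡ countR w

Nonempty : Word → Set
Nonempty w = w ≢ []

Prime : Word → Set
Prime w = Nonempty w × Balanced w ×
  ¬ (Σ Word λ u → Σ Word λ v →
       Nonempty u × Balanced u × Nonempty v × Balanced v × (u ++ v ≡ w))

bar : Letter → ℤ
bar R = 1ℤ
bar L = -1ℤ

wt : Word → ℤ
wt []      = 0ℤ
wt (a ∷ w) = bar a ℤ.+ wt w

e : ℕ → Word → ℤ
e k w = wt (take k w)

UpperPrime : Word → Set
UpperPrime P = Prime P × (∀ k → 1 ≤ k → k < length P → 0ℤ ℤ.< e k P)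

LowerPrime : Word → Set
LowerPrime P = Prime P × (∀ k → 1 ≤ k → k < length P → e k P ℤ.< 0ℤ)

-- The free associative algebra K⟨L,R⟩ over a commutative ring K,
-- elements represented as finite formal sums of (coefficient, word),
-- compared by their coefficient functions.

module FreeAlg {c ℓ : Level} (K : CommutativeRing c ℓ) where
  open CommutativeRing K renaming (Carrier to Kc)

  Poly : Set c
  Poly = List (Kc × Word)

  coeff : Poly → Word → Kc
  coeff []             w = 0#
  coeff ((a , u) ∷ p)  w with u ≟W w
  ... | yes _ = a + coeff p w
  ... | no  _ = coeff p w

  _≈P_ : Poly → Poly → Set ℓ
  p ≈P q = ∀ w → coeff p w ≈ coeff q w

  Term : Set c
  Term = Kc × Word × Word × Word × Word

  termPoly : Term → Poly
  termPoly (k , a , F , G , b) =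
    (k , a ++ F ++ G ++ b) ∷ (- k , a ++ G ++ F ++ b) ∷ []

  sumTerms : List Term → Poly
  sumTerms ts = concat (map termPoly ts)

  genPair : Term → Word × Word
  genPair (_ , _ , F , G , _) = F , G

  -- x lies in the two-sided ideal generated by { F G − G F : Gen F G }
  -- (the ideal is spanned by the elements c · a · g · b with a, b words)
  InIdeal : (Word → Word → Set) → Poly → Set (c ⊔ ℓ)
  InIdeal Gen x = Σ (List Term) λ ts →
    All (λ t → Gen (Data.Product.proj₁ (genPair t)) (Data.Product.proj₂ (genPair t))) ts
    × (x ≈P sumTerms ts)

SGen : Word → Word → Set
SGen F G = Nonempty F × Balanced F × Nonempty G × Balanced G

S''Gen : Word → Word → Set
S''Gen U D = UpperPrime U × LowerPrime D

-- A balanced word factors into primes of the form o A ō (o = R upper, o = L lower, ō the other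
-- letter), A itself a product of primes of the same kind; the factorisation is obtained by reading
-- the word from the right while counting unmatched closing letters. Modulo the congruence generated
-- by S'', an upper and a lower prime commute by definition. Two upper primes R A L and R B L commute:
-- the junction L R is a lower prime, so it moves past B, turning R A L R B L into R A B L R L; the
-- bodies A B commute by induction, and the same moves backwards give R B L R A L (likewise for
-- lower primes). Hence any two balanced words commute modulo S'', so every element of S lies in
-- the ideal generated by S''; the converse holds because S'' ⊆ S.
module Submission where

open import Defs
open import Level using (Level)
open import Data.Product using (_×_; _,_)
open import Algebra.Bundles using (CommutativeRing)

module Words where

  open import Level using (0ℓ)
  open import Data.Nat as ℕ using (ℕ; zero; suc; z≤n; s≤s; _∸_)
  import Data.Nat.Properties as ℕ
  open import Data.Integer as ℤ using (ℤ; +_; 0ℤ; 1ℤ; -1ℤ; _⊖_; -_; _+_; _≤_; _<_)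
  import Data.Integer.Properties as ℤ
  open import Data.List using ([]; _∷_; _++_; length; take; [_])
  open import Data.List.Properties using (++-assoc; ++-identityʳ; length-++; take-all; take-[]; ++-monoid)
  open import Data.Product using (Σ; _,_)
  open import Relation.Nullary using (yes; no)
  open import Data.Empty using (⊥-elim)
  open import Relation.Binary.PropositionalEquality using (_≡_; _≢_; refl; sym; trans; cong; cong₂; subst; subst₂; module ≡-Reasoning)
  open import Relation.Binary.Core using (Rel)
  import Relation.Binary.Reasoning.Setoid
  open import Relation.Binary.Construct.Closure.Equivalence as EqClosure using (EqClosure)
  open import Tactic.MonoidSolver using (solve)

  wt-++ : ∀ x y → wt (x ++ y) ≡ wt x + wt y
  wt-++ []      y = sym (ℤ.+-identityˡ (wt y))
  wt-++ (a ∷ x) y = trans (cong (_+_ (bar a)) (wt-++ x y)) (sym (ℤ.+-assoc (bar a) (wt x) (wt y)))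

  wt≡countR⊖countL : ∀ w → wt w ≡ countR w ⊖ countL w
  wt≡countR⊖countL []      = refl
  wt≡countR⊖countL (L ∷ w) = trans (cong (_+_ -1ℤ) (wt≡countR⊖countL w)) (ℤ.distribʳ-⊖-+-neg 0 (countR w) (countL w))
  wt≡countR⊖countL (R ∷ w) = trans (cong (_+_ 1ℤ) (wt≡countR⊖countL w)) (ℤ.distribʳ-⊖-+-pos 1 (countR w) (countL w))

  balanced⇒wt≡0 : ∀ {w} → Balanced w → wt w ≡ 0ℤ
  balanced⇒wt≡0 {w} bal = trans (wt≡countR⊖countL w) (trans (cong (countR w ⊖_) bal) (ℤ.n⊖n≡0 (countR w)))

  wt≡0⇒balanced : ∀ {w} → wt w ≡ 0ℤ → Balanced w
  wt≡0⇒balanced {w} wt≡0 = sym (ℤ.+-injective (ℤ.i-j≡0⇒i≡j (+ countR w) (+ countL w)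
    (trans (ℤ.m-n≡m⊖n (countR w) (countL w)) (trans (sym (wt≡countR⊖countL w)) wt≡0))))

  take-++ : ∀ k (x y : Word) → take k (x ++ y) ≡ take k x ++ take (k ∸ length x) y
  take-++ zero    []      y = refl
  take-++ zero    (a ∷ x) y = refl
  take-++ (suc k) []      y = refl
  take-++ (suc k) (a ∷ x) y = cong (a ∷_) (take-++ k x y)

  take-++ˡ : ∀ {k} (x y : Word) → k ℕ.≤ length x → take k (x ++ y) ≡ take k x
  take-++ˡ {zero}  x       y _         = refl
  take-++ˡ {suc k} (a ∷ x) y (s≤s k≤) = cong (a ∷_) (take-++ˡ x y k≤)

  take-length-++ : ∀ (x y : Word) → take (length x) (x ++ y) ≡ x
  take-length-++ []      y = refl
  take-length-++ (a ∷ x) y = cong (a ∷_) (take-length-++ x y)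

  prime-if-no-balanced-prefix : ∀ {P} → Nonempty P → Balanced P →
    (∀ k → 1 ℕ.≤ k → k ℕ.< length P → e k P ≢ 0ℤ) → Prime P
  prime-if-no-balanced-prefix {P} P≢[] balP no-prefix =
    P≢[] , balP , λ (u , v , u≢[] , balU , v≢[] , _ , u++v≡P) →
      no-prefix (length u) (1≤length u≢[]) (proper u v≢[] u++v≡P) (prefix-weight {u} u++v≡P balU)
    where
    1≤length : ∀ {u : Word} → Nonempty u → 1 ℕ.≤ length u
    1≤length {[]}    u≢[] = ⊥-elim (u≢[] refl)
    1≤length {_ ∷ _} _    = s≤s z≤n
    proper : ∀ u {v} → Nonempty v → u ++ v ≡ P → length u ℕ.< length P
    proper u {v} v≢[] refl = subst (length u ℕ.<_) (sym (length-++ u)) (ℕ.m<m+n (length u) (1≤length v≢[]))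
    prefix-weight : ∀ {u v} → u ++ v ≡ P → Balanced u → e (length u) P ≡ 0ℤ
    prefix-weight {u} {v} refl balU = trans (cong wt (take-length-++ u v)) (balanced⇒wt≡0 {u} balU)

  opposite : Letter → Letter
  opposite L = R
  opposite R = L

  height : Letter → Word → ℤ
  height R w = wt w
  height L w = - wt w

  height-++ : ∀ o x y → height o (x ++ y) ≡ height o x + height o y
  height-++ R x y = wt-++ x y
  height-++ L x y = trans (cong -_ (wt-++ x y)) (ℤ.neg-distrib-+ (wt x) (wt y))

  height-opener : ∀ o → height o [ o ] ≡ 1ℤ
  height-opener L = refl
  height-opener R = refl

  height-closer : ∀ o → height o [ opposite o ] ≡ -1ℤ
  height-closer L = refl
  height-closer R = refl

  balanced⇒height≡0 : ∀ o {w} → Balanced w → height o w ≡ 0ℤ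
  balanced⇒height≡0 R {w} bal = balanced⇒wt≡0 {w} bal
  balanced⇒height≡0 L {w} bal = cong -_ (balanced⇒wt≡0 {w} bal)

  height≡0⇒balanced : ∀ o {w} → height o w ≡ 0ℤ → Balanced w
  height≡0⇒balanced R {w} h≡0 = wt≡0⇒balanced {w} h≡0
  height≡0⇒balanced L {w} h≡0 = wt≡0⇒balanced {w} (ℤ.neg-injective h≡0)

  infixr 5 _∷_

  data Concat (P : Word → Set) : Word → Set where
    []  : Concat P []
    _∷_ : ∀ {p q} → P p → Concat P q → Concat P (p ++ q)

  Concat-++ : ∀ {P x y} → Concat P x → Concat P y → Concat P (x ++ y)
  Concat-++             []                   ys = ys
  Concat-++ {y = y} (_∷_ {p} {q} x xs) ys = subst (Concat _) (sym (++-assoc p q y)) (x ∷ Concat-++ xs ys)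

  Concat-map : ∀ {P Q : Word → Set} → (∀ {w} → P w → Q w) → ∀ {w} → Concat P w → Concat Q w
  Concat-map f []       = []
  Concat-map f (x ∷ xs) = f x ∷ Concat-map f xs

  data Prim (o : Letter) : Word → Set where
    prim : ∀ {A} → Concat (Prim o) A → Prim o (o ∷ A ++ [ opposite o ])

  height-[] : ∀ o → height o [] ≡ 0ℤ
  height-[] L = refl
  height-[] R = refl

  mutual
    Prim-height : ∀ {o w} → Prim o w → height o w ≡ 0ℤ
    Prim-height {o} (prim {A} as) = begin
      height o ([ o ] ++ A ++ [ opposite o ])                 ≡⟨ height-++ o [ o ] _ ⟩
      height o [ o ] + height o (A ++ [ opposite o ])         ≡⟨ cong (_+_ (height o [ o ])) (height-++ o A _) ⟩
      height o [ o ] + (height o A + height o [ opposite o ]) ≡⟨ cong₂ (λ h h′ → h + (h′ + height o [ opposite o ]))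
                                                                     (height-opener o) (Prims-height as) ⟩
      1ℤ + (0ℤ + height o [ opposite o ])                     ≡⟨ cong (λ h → 1ℤ + (0ℤ + h)) (height-closer o) ⟩
      0ℤ                                                      ∎
      where open ≡-Reasoning

    Prims-height : ∀ {o w} → Concat (Prim o) w → height o w ≡ 0ℤ
    Prims-height {o} []                 = height-[] o
    Prims-height {o} (_∷_ {p} {q} x xs) = trans (height-++ o p q) (cong₂ _+_ (Prim-height x) (Prims-height xs))

  0≤x⇒0<1+x : ∀ {x} → 0ℤ ≤ x → 0ℤ < 1ℤ + x
  0≤x⇒0<1+x 0≤x = ℤ.<-≤-trans (ℤ.+<+ (s≤s z≤n)) (ℤ.+-monoʳ-≤ 1ℤ 0≤x)

  mutual
    Prim-prefix-positive : ∀ {o w} → Prim o w → ∀ k → 1 ℕ.≤ k → k ℕ.< length w → 0ℤ < height o (take k w)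
    Prim-prefix-positive {o} (prim {A} as) (suc k) _ (s≤s k<) =
      subst (0ℤ <_) (sym height-prefix) (0≤x⇒0<1+x (Prims-prefix-nonneg as k))
      where
      k≤∣A∣ : k ℕ.≤ length A
      k≤∣A∣ = ℕ.m<1+n⇒m≤n (subst (k ℕ.<_) (trans (length-++ A) (ℕ.+-comm (length A) 1)) k<)
      height-prefix : height o ([ o ] ++ take k (A ++ [ opposite o ])) ≡ 1ℤ + height o (take k A)
      height-prefix = trans (height-++ o [ o ] _)
                            (cong₂ _+_ (height-opener o) (cong (height o) (take-++ˡ A _ k≤∣A∣)))

    Prim-prefix-nonneg : ∀ {o w} → Prim o w → ∀ k → 0ℤ ≤ height o (take k w)
    Prim-prefix-nonneg {o}     p zero = ℤ.≤-reflexive (sym (height-[] o))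
    Prim-prefix-nonneg {o} {w} p (suc k) with suc k ℕ.<? length w
    ... | yes k< = ℤ.<⇒≤ (Prim-prefix-positive p (suc k) (s≤s z≤n) k<)
    ... | no  k≮ = ℤ.≤-reflexive (sym (trans (cong (height o) (take-all (suc k) w (ℕ.≮⇒≥ k≮))) (Prim-height p)))

    Prims-prefix-nonneg : ∀ {o w} → Concat (Prim o) w → ∀ k → 0ℤ ≤ height o (take k w)
    Prims-prefix-nonneg {o} [] k = ℤ.≤-reflexive (sym (trans (cong (height o) (take-[] k)) (height-[] o)))
    Prims-prefix-nonneg {o} (_∷_ {p} {q} x xs) k =
      subst (0ℤ ≤_) (sym (trans (cong (height o) (take-++ k p q)) (height-++ o _ _)))
        (ℤ.+-mono-≤ (Prim-prefix-nonneg x k) (Prims-prefix-nonneg xs (k ∸ length p)))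

  Prim-nonempty : ∀ {o w} → Prim o w → Nonempty w
  Prim-nonempty (prim _) ()

  Prim-balanced : ∀ {o w} → Prim o w → Balanced w
  Prim-balanced {o} p = height≡0⇒balanced o (Prim-height p)

  Prim-prime : ∀ {o w} → Prim o w → Prime w
  Prim-prime {o} {w} p = prime-if-no-balanced-prefix (Prim-nonempty p) (Prim-balanced p)
    λ k 1≤k k< e≡0 → ℤ.<-irrefl (sym (balanced⇒height≡0 o (wt≡0⇒balanced {take k w} e≡0)))
                                   (Prim-prefix-positive p k 1≤k k<)

  Prim-upperPrime : ∀ {w} → Prim R w → UpperPrime w
  Prim-upperPrime p = Prim-prime p , Prim-prefix-positive p

  Prim-lowerPrime : ∀ {w} → Prim L w → LowerPrime w
  Prim-lowerPrime p = Prim-prime p , λ k 1≤k k< →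
    subst (_< 0ℤ) (ℤ.neg-involutive _) (ℤ.neg-mono-< (Prim-prefix-positive p k 1≤k k<))

  Factorisation : Word → Set
  Factorisation = Concat (λ w → Σ Letter λ o → Prim o w)

  Factorisation-height : ∀ o {w} → Factorisation w → height o w ≡ 0ℤ
  Factorisation-height o []                       = height-[] o
  Factorisation-height o (_∷_ {p} {q} (_ , x) xs) =
    trans (height-++ o p q) (cong₂ _+_ (balanced⇒height≡0 o (Prim-balanced x)) (Factorisation-height o xs))

  -- Unmatched o n Y: Y = A₀ ō A₁ ō ⋯ ō Aₙ with each Aᵢ a product of o-primes.
  data Unmatched (o : Letter) : ℕ → Word → Set where
    matched   : ∀ {A} → Concat (Prim o) A → Unmatched o 0 A
    unmatched : ∀ {n A B} → Concat (Prim o) A → Unmatched o n B → Unmatched o (suc n) (A ++ opposite o ∷ B)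

  Unmatched-prepend : ∀ {o n p Y} → Prim o p → Unmatched o n Y → Unmatched o n (p ++ Y)
  Unmatched-prepend x (matched xs) = matched (x ∷ xs)
  Unmatched-prepend {p = p} x (unmatched {A = A} xs u) =
    subst (Unmatched _ _) (++-assoc p A _) (unmatched (x ∷ xs) u)

  Unmatched-match : ∀ {o n Y} → Unmatched o (suc n) Y → Unmatched o n (o ∷ Y)
  Unmatched-match {o} (unmatched {A = A} {B} xs u) =
    subst (Unmatched _ _) (cong (o ∷_) (++-assoc A [ opposite o ] B)) (Unmatched-prepend (prim xs) u)

  Unmatched-height : ∀ {o n Y} → Unmatched o n Y → height o Y ≡ - (+ n)
  Unmatched-height (matched xs) = Prims-height xs
  Unmatched-height {o} {suc n} (unmatched {A = A} {B} xs u) = begin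
    height o (A ++ [ opposite o ] ++ B)                   ≡⟨ height-++ o A _ ⟩
    height o A + height o ([ opposite o ] ++ B)           ≡⟨ cong (_+_ (height o A)) (height-++ o [ opposite o ] B) ⟩
    height o A + (height o [ opposite o ] + height o B)   ≡⟨ cong₂ (λ h h′ → h + (h′ + height o B)) (Prims-height xs) (height-closer o) ⟩
    0ℤ + (-1ℤ + height o B)                               ≡⟨ ℤ.+-identityˡ _ ⟩
    -1ℤ + height o B                                      ≡⟨ cong (_+_ -1ℤ) (Unmatched-height u) ⟩
    -1ℤ + - (+ n)                                         ≡⟨ -1+-n≡-[1+n] n ⟩
    - (+ suc n)                                           ∎
    where
    open ≡-Reasoning
    -1+-n≡-[1+n] : ∀ n → -1ℤ + - (+ n) ≡ - (+ suc n)
    -1+-n≡-[1+n] zero    = refl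
    -1+-n≡-[1+n] (suc n) = refl

  height≡0⇒matched : ∀ {o n Y} → Unmatched o n Y → height o Y ≡ 0ℤ → Concat (Prim o) Y
  height≡0⇒matched (matched xs)    _      = xs
  height≡0⇒matched (unmatched xs u) Y≡0 with trans (sym (Unmatched-height (unmatched xs u))) Y≡0
  ... | ()

  data Side (o : Letter) : Letter → Set where
    opener : Side o o
    closer : Side o (opposite o)

  side : ∀ o a → Side o a
  side L L = opener
  side L R = closer
  side R L = closer
  side R R = opener

  unmatched-closer : ∀ o → Unmatched (opposite o) 1 [ o ]
  unmatched-closer L = unmatched [] (matched [])
  unmatched-closer R = unmatched [] (matched [])

  data Parsed : Word → Set where
    _∙_ : ∀ {o n Y T} → Unmatched o n Y → Factorisation T → Parsed (Y ++ T)

  parse-step : ∀ {o a n Y T} → Side o a → Unmatched o n Y → Factorisation T → Parsed (a ∷ Y ++ T)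
  parse-step         closer u                   f = unmatched [] u ∙ f
  parse-step {o}     opener (matched xs)        f = unmatched-closer o ∙ Concat-++ (Concat-map (o ,_) xs) f
  parse-step         opener u@(unmatched _ _)   f = Unmatched-match u ∙ f

  parse : ∀ w → Parsed w
  parse []      = matched {o = R} [] ∙ []
  parse (a ∷ w) with parse w
  ... | _∙_ {o} u f = parse-step (side o a) u f

  factorise : ∀ {w} → Balanced w → Factorisation w
  factorise {w} bal with parse w
  ... | _∙_ {o} {Y = Y} {T} u f = Concat-++ (Concat-map (o ,_) (height≡0⇒matched u height-Y≡0)) f
    where
    open ≡-Reasoning
    height-Y≡0 : height o Y ≡ 0ℤ
    height-Y≡0 = begin
      height o Y                ≡⟨ sym (ℤ.+-identityʳ _) ⟩
      height o Y + 0ℤ           ≡⟨ cong (_+_ (height o Y)) (sym (Factorisation-height o f)) ⟩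
      height o Y + height o T   ≡⟨ sym (height-++ o Y T) ⟩
      height o (Y ++ T)         ≡⟨ balanced⇒height≡0 o bal ⟩
      0ℤ                        ∎

  data Swap (Gen : Word → Word → Set) : Rel Word 0ℓ where
    swap : ∀ a b {F G} → Gen F G → Swap Gen (a ++ F ++ G ++ b) (a ++ G ++ F ++ b)

  swap-here : ∀ {Gen F G} → Gen F G → Swap Gen (F ++ G) (G ++ F)
  swap-here {F = F} {G} g = subst₂ (Swap _) (cong (F ++_) (++-identityʳ G)) (cong (G ++_) (++-identityʳ F)) (swap [] [] g)

  Swap-context : ∀ {Gen} c d {X Y} → Swap Gen X Y → Swap Gen (c ++ X ++ d) (c ++ Y ++ d)
  Swap-context c d (swap a b {F} {G} g) = subst₂ (Swap _) (reassociate F G) (reassociate G F) (swap (c ++ a) (b ++ d) g)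
    where
    reassociate : ∀ F G → (c ++ a) ++ F ++ G ++ b ++ d ≡ c ++ (a ++ F ++ G ++ b) ++ d
    reassociate F G = solve (++-monoid Letter)

  infix 4 _∼_
  _∼_ : Rel Word 0ℓ
  _∼_ = EqClosure (Swap S''Gen)

  module ∼-Reasoning = Relation.Binary.Reasoning.Setoid (EqClosure.setoid (Swap S''Gen))

  ∼-context : ∀ c d {X Y} → X ∼ Y → c ++ X ++ d ∼ c ++ Y ++ d
  ∼-context c d = EqClosure.gmap (λ X → c ++ X ++ d) (Swap-context c d)

  record Commute (x y : Word) : Set where
    constructor commute
    field commutes : x ++ y ∼ y ++ x
  open Commute

  commute-sym : ∀ {x y} → Commute x y → Commute y x
  commute-sym (commute xy) = commute (EqClosure.symmetric _ xy)

  commute-[]ˡ : ∀ y → Commute [] y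
  commute-[]ˡ y = commute (subst (y ∼_) (sym (++-identityʳ y)) (EqClosure.reflexive _))

  commute-++ˡ : ∀ {x y z} → Commute x z → Commute y z → Commute (x ++ y) z
  commute-++ˡ {x} {y} {z} (commute xz) (commute yz) = commute (begin
    (x ++ y) ++ z        ≡⟨ solve (++-monoid Letter) ⟩
    x ++ (y ++ z) ++ []  ≈⟨ ∼-context x [] yz ⟩
    x ++ (z ++ y) ++ []  ≡⟨ solve (++-monoid Letter) ⟩
    [] ++ (x ++ z) ++ y  ≈⟨ ∼-context [] y xz ⟩
    [] ++ (z ++ x) ++ y  ≡⟨ solve (++-monoid Letter) ⟩
    z ++ x ++ y          ∎)
    where open ∼-Reasoning

  Concat-commute : ∀ {P z} → (∀ {p} → P p → Commute p z) → ∀ {w} → Concat P w → Commute w z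
  Concat-commute h []       = commute-[]ˡ _
  Concat-commute h (x ∷ xs) = commute-++ˡ (h x) (Concat-commute h xs)

  commute-opposite : ∀ {o u v} → Prim o u → Prim (opposite o) v → Commute u v
  commute-opposite {R} x y = commute (EqClosure.return (swap-here (Prim-upperPrime x , Prim-lowerPrime y)))
  commute-opposite {L} x y = commute-sym (commute (EqClosure.return (swap-here (Prim-upperPrime y , Prim-lowerPrime x))))

  opposite-pair : ∀ o → Prim (opposite o) (opposite o ∷ [ o ])
  opposite-pair L = prim []
  opposite-pair R = prim []

  -- Where x A y and x B y meet, the junction y x is moved past B.
  gather : ∀ {x y A B} → Commute (y ++ x) B → (x ++ A ++ y) ++ (x ++ B ++ y) ∼ x ++ (A ++ B) ++ (y ++ x ++ y)
  gather {x} {y} {A} {B} (commute yx-B) = begin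
    (x ++ A ++ y) ++ (x ++ B ++ y)    ≡⟨ solve (++-monoid Letter) ⟩
    (x ++ A) ++ ((y ++ x) ++ B) ++ y  ≈⟨ ∼-context (x ++ A) y yx-B ⟩
    (x ++ A) ++ (B ++ (y ++ x)) ++ y  ≡⟨ solve (++-monoid Letter) ⟩
    x ++ (A ++ B) ++ (y ++ x ++ y)    ∎
    where open ∼-Reasoning

  mutual
    Prim-commute : ∀ {o u v} → Prim o u → Prim o v → Commute u v
    Prim-commute {o} (prim {A} xs) (prim {B} ys) = commute (begin
      ([ o ] ++ A ++ ō) ++ ([ o ] ++ B ++ ō)  ≈⟨ gather {[ o ]} {ō} {A} (junction-commutes ys) ⟩
      [ o ] ++ (A ++ B) ++ (ō ++ [ o ] ++ ō)  ≈⟨ ∼-context [ o ] _ (commutes (Prims-commute xs ys)) ⟩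
      [ o ] ++ (B ++ A) ++ (ō ++ [ o ] ++ ō)  ≈⟨ gather {[ o ]} {ō} {B} (junction-commutes xs) ⟨
      ([ o ] ++ B ++ ō) ++ ([ o ] ++ A ++ ō)  ∎)
      where
      open ∼-Reasoning
      ō = [ opposite o ]
      junction-commutes : ∀ {C} → Concat (Prim o) C → Commute (ō ++ [ o ]) C
      junction-commutes zs = commute-sym (Concat-commute (λ z → commute-opposite z (opposite-pair o)) zs)

    Prims-commute : ∀ {o A B} → Concat (Prim o) A → Concat (Prim o) B → Commute A B
    Prims-commute []       ys = commute-[]ˡ _
    Prims-commute (x ∷ xs) ys = commute-++ˡ (Prim-Prims-commute x ys) (Prims-commute xs ys)

    Prim-Prims-commute : ∀ {o u B} → Prim o u → Concat (Prim o) B → Commute u B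
    Prim-Prims-commute x []       = commute-sym (commute-[]ˡ _)
    Prim-Prims-commute x (y ∷ ys) =
      commute-sym (commute-++ˡ (commute-sym (Prim-commute x y)) (commute-sym (Prim-Prims-commute x ys)))

  primes-commute : ∀ {o o′ u v} → Prim o u → Prim o′ v → Commute u v
  primes-commute {o} {o′} x y with side o o′
  ... | opener = Prim-commute x y
  ... | closer = commute-opposite x y

  balanced-commute : ∀ {F G} → Balanced F → Balanced G → Commute F G
  balanced-commute bF bG =
    Concat-commute (λ (_ , x) → commute-sym (Concat-commute (λ (_ , y) → primes-commute y x) (factorise bG))) (factorise bF)

  balanced-swap : ∀ {F G} → SGen F G → ∀ a b → a ++ F ++ G ++ b ∼ a ++ G ++ F ++ b
  balanced-swap {F} {G} (_ , bF , _ , bG) a b = begin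
    a ++ F ++ G ++ b    ≡⟨ solve (++-monoid Letter) ⟩
    a ++ (F ++ G) ++ b  ≈⟨ ∼-context a b (commutes (balanced-commute {F} {G} bF bG)) ⟩
    a ++ (G ++ F) ++ b  ≡⟨ solve (++-monoid Letter) ⟩
    a ++ G ++ F ++ b    ∎
    where open ∼-Reasoning

  S''Gen⊆SGen : ∀ {U D} → S''Gen U D → SGen U D
  S''Gen⊆SGen (((U≢[] , balU , _) , _) , ((D≢[] , balD , _) , _)) = U≢[] , balU , D≢[] , balD

module Ideals {c ℓ : Level} (K : CommutativeRing c ℓ) where

  open import Level using (_⊔_)
  open import Data.Product using (_,_; proj₁; proj₂)
  open import Data.List using ([]; _∷_; _++_; [_]; concat; map)
  open import Data.List.Properties using (++-identityʳ; concat-++; map-++)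
  open import Data.List.Relation.Unary.All using (All; []; _∷_)
  open import Data.List.Relation.Unary.All.Properties using (++⁺)
  open import Relation.Binary.PropositionalEquality as ≡ using (_≡_)
  open import Relation.Binary.Construct.Closure.Equivalence using (EqClosure)
  open import Relation.Binary.Construct.Closure.ReflexiveTransitive using (ε; _◅_)
  open import Relation.Binary.Construct.Closure.Symmetric using (fwd; bwd)
  open import Relation.Nullary using (yes; no)
  open FreeAlg K
  open CommutativeRing K renaming (Carrier to Kc)
  open import Algebra.Properties.AbelianGroup +-abelianGroup using (⁻¹-involutive; ε⁻¹≈ε)
  open import Relation.Binary.Reasoning.Setoid setoid
  open Words using (Swap; swap)

  coeff-∷ : ∀ k u p w → coeff ((k , u) ∷ p) w ≈ coeff [ (k , u) ] w + coeff p w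
  coeff-∷ k u p w with u ≟W w
  ... | yes _ = +-congʳ (sym (+-identityʳ k))
  ... | no  _ = sym (+-identityˡ _)

  coeff-++ : ∀ p q w → coeff (p ++ q) w ≈ coeff p w + coeff q w
  coeff-++ []             q w = sym (+-identityˡ _)
  coeff-++ ((k , u) ∷ p) q w = begin
    coeff ((k , u) ∷ p ++ q) w                        ≈⟨ coeff-∷ k u (p ++ q) w ⟩
    coeff [ (k , u) ] w + coeff (p ++ q) w             ≈⟨ +-congˡ (coeff-++ p q w) ⟩
    coeff [ (k , u) ] w + (coeff p w + coeff q w)      ≈⟨ +-assoc _ _ _ ⟨
    (coeff [ (k , u) ] w + coeff p w) + coeff q w      ≈⟨ +-congʳ (coeff-∷ k u p w) ⟨
    coeff ((k , u) ∷ p) w + coeff q w                  ∎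

  coeff-neg : ∀ k u w → coeff [ (- k , u) ] w ≈ - coeff [ (k , u) ] w
  coeff-neg k u w with u ≟W w
  ... | yes _ = trans (+-identityʳ _) (-‿cong (sym (+-identityʳ k)))
  ... | no  _ = sym ε⁻¹≈ε

  -- termPoly (k , a , F , G , b) is definitionally diff k (a ++ F ++ G ++ b) (a ++ G ++ F ++ b).
  diff : Kc → Word → Word → Poly
  diff k X Y = (k , X) ∷ (- k , Y) ∷ []

  coeff-diff : ∀ k X Y w → coeff (diff k X Y) w ≈ coeff [ (k , X) ] w - coeff [ (k , Y) ] w
  coeff-diff k X Y w = trans (coeff-∷ k X _ w) (+-congˡ (coeff-neg k Y w))

  diff-refl : ∀ k X → diff k X X ≈P []
  diff-refl k X w = trans (coeff-diff k X X w) (-‿inverseʳ _)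

  diff-sym : ∀ k X Y → diff k Y X ≈P diff (- k) X Y
  diff-sym k X Y w = begin
    coeff (diff k Y X) w                            ≈⟨ coeff-diff k Y X w ⟩
    coeff [ (k , Y) ] w - coeff [ (k , X) ] w       ≈⟨ +-comm _ _ ⟩
    - coeff [ (k , X) ] w + coeff [ (k , Y) ] w     ≈⟨ +-cong (coeff-neg k X w) (⁻¹-involutive _) ⟨
    coeff [ (- k , X) ] w - - coeff [ (k , Y) ] w   ≈⟨ +-congˡ (-‿cong (coeff-neg k Y w)) ⟨
    coeff [ (- k , X) ] w - coeff [ (- k , Y) ] w   ≈⟨ coeff-diff (- k) X Y w ⟨
    coeff (diff (- k) X Y) w                        ∎

  diff-trans : ∀ k X Y Z → diff k X Z ≈P (diff k X Y ++ diff k Y Z)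
  diff-trans k X Y Z w = begin
    coeff (diff k X Z) w                          ≈⟨ coeff-diff k X Z w ⟩
    x - z                                         ≈⟨ +-congʳ (+-identityʳ x) ⟨
    (x + 0#) - z                                  ≈⟨ +-congʳ (+-congˡ (-‿inverseˡ y)) ⟨
    (x + (- y + y)) - z                           ≈⟨ +-congʳ (+-assoc x (- y) y) ⟨
    ((x - y) + y) - z                             ≈⟨ +-assoc (x - y) y (- z) ⟩
    (x - y) + (y - z)                             ≈⟨ +-cong (coeff-diff k X Y w) (coeff-diff k Y Z w) ⟨
    coeff (diff k X Y) w + coeff (diff k Y Z) w   ≈⟨ coeff-++ (diff k X Y) (diff k Y Z) w ⟨
    coeff (diff k X Y ++ diff k Y Z) w            ∎
    where
    x = coeff [ (k , X) ] w
    y = coeff [ (k , Y) ] w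
    z = coeff [ (k , Z) ] w

  sumTerms-++ : ∀ ts us → sumTerms (ts ++ us) ≡ sumTerms ts ++ sumTerms us
  sumTerms-++ ts us = ≡.trans (≡.cong concat (map-++ termPoly ts us)) (≡.sym (concat-++ (map termPoly ts) (map termPoly us)))

  module _ {Gen : Word → Word → Set} where

    InIdeal-resp : ∀ {x y} → x ≈P y → InIdeal Gen y → InIdeal Gen x
    InIdeal-resp x≈y (ts , gs , y≈) = ts , gs , λ w → trans (x≈y w) (y≈ w)

    InIdeal-[] : InIdeal Gen []
    InIdeal-[] = [] , [] , λ w → refl

    InIdeal-++ : ∀ {x y} → InIdeal Gen x → InIdeal Gen y → InIdeal Gen (x ++ y)
    InIdeal-++ {x} {y} (ts , gs , x≈) (us , hs , y≈) = ts ++ us , ++⁺ gs hs , λ w → begin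
      coeff (x ++ y) w                                ≈⟨ coeff-++ x y w ⟩
      coeff x w + coeff y w                           ≈⟨ +-cong (x≈ w) (y≈ w) ⟩
      coeff (sumTerms ts) w + coeff (sumTerms us) w   ≈⟨ coeff-++ (sumTerms ts) (sumTerms us) w ⟨
      coeff (sumTerms ts ++ sumTerms us) w            ≡⟨ ≡.cong (λ p → coeff p w) (sumTerms-++ ts us) ⟨
      coeff (sumTerms (ts ++ us)) w                   ∎

    record _≃_ (X Y : Word) : Set (c ⊔ ℓ) where
      constructor multiples-in-ideal
      field diff-in-ideal : ∀ k → InIdeal Gen (diff k X Y)
    open _≃_ public

    ≃-refl : ∀ {X} → X ≃ X
    ≃-refl {X} = multiples-in-ideal λ k →
      InIdeal-resp {x = diff k X X} {y = []} (diff-refl k X) InIdeal-[]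

    ≃-sym : ∀ {X Y} → X ≃ Y → Y ≃ X
    ≃-sym {X} {Y} (multiples-in-ideal X-Y) = multiples-in-ideal λ k →
      InIdeal-resp {x = diff k Y X} {y = diff (- k) X Y} (diff-sym k X Y) (X-Y (- k))

    ≃-trans : ∀ {X Y Z} → X ≃ Y → Y ≃ Z → X ≃ Z
    ≃-trans {X} {Y} {Z} (multiples-in-ideal X-Y) (multiples-in-ideal Y-Z) = multiples-in-ideal λ k →
      InIdeal-resp {x = diff k X Z} {y = diff k X Y ++ diff k Y Z} (diff-trans k X Y Z)
        (InIdeal-++ {x = diff k X Y} {y = diff k Y Z} (X-Y k) (Y-Z k))

    swap⇒≃ : ∀ {X Y} → Swap Gen X Y → X ≃ Y
    swap⇒≃ (swap a b {F} {G} g) = multiples-in-ideal λ k →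
      [ (k , a , F , G , b) ] , g ∷ [] ,
        λ w → reflexive (≡.cong (λ p → coeff p w) (≡.sym (++-identityʳ (termPoly (k , a , F , G , b)))))

    EqClosure⇒≃ : ∀ {X Y} → EqClosure (Swap Gen) X Y → X ≃ Y
    EqClosure⇒≃ ε           = ≃-refl
    EqClosure⇒≃ (fwd s ◅ p) = ≃-trans (swap⇒≃ s) (EqClosure⇒≃ p)
    EqClosure⇒≃ (bwd s ◅ p) = ≃-trans (≃-sym (swap⇒≃ s)) (EqClosure⇒≃ p)

  InIdeal-transfer : ∀ {Gen Gen′ : Word → Word → Set} →
    (∀ {F G} → Gen F G → ∀ a b → EqClosure (Swap Gen′) (a ++ F ++ G ++ b) (a ++ G ++ F ++ b)) →
    ∀ x → InIdeal Gen x → InIdeal Gen′ x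
  InIdeal-transfer {Gen} {Gen′} swaps x (ts , gs , x≈) = InIdeal-resp {x = x} {y = sumTerms ts} x≈ (sum-in-ideal ts gs)
    where
    sum-in-ideal : ∀ ts → All (λ t → Gen (proj₁ (genPair t)) (proj₂ (genPair t))) ts → InIdeal Gen′ (sumTerms ts)
    sum-in-ideal []                         []       = InIdeal-[]
    sum-in-ideal ((k , a , F , G , b) ∷ ts) (g ∷ gs) =
      InIdeal-++ {x = diff k (a ++ F ++ G ++ b) (a ++ G ++ F ++ b)} {y = sumTerms ts}
        (diff-in-ideal (EqClosure⇒≃ (swaps g a b)) k) (sum-in-ideal ts gs)

open Words using (swap; balanced-swap; S''Gen⊆SGen)
open Ideals using (InIdeal-transfer)
open import Relation.Binary.Construct.Closure.Equivalence as EqClosure using ()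

proposition5p3 : {c ℓ : Level} (K : CommutativeRing c ℓ) →
    let open FreeAlg K in
    (x : Poly) → (InIdeal SGen x → InIdeal S''Gen x) × (InIdeal S''Gen x → InIdeal SGen x)
proposition5p3 K x =
  InIdeal-transfer K balanced-swap x ,
  InIdeal-transfer K (λ g a b → EqClosure.return (swap a b (S''Gen⊆SGen g))) x
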